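{- Let $N=\{1,\dots,n\}$, let $H\subseteq 2^N\setminus\{\varnothing,N\}$ be a poset ordered by inclusion, and suppose its two top layers $T_H$, with $h$ nodes in the upper layer, are closed under intersection. Then exactly one of the following holds: (Situation 1) every node $y$ of the lower layer satisfies $|\mathsf{prec}(y)|\le 2$; or (Situation 2) $h\geq 3$ and there exists a unique node $y$ of the lower layer with $|\mathsf{prec}(y)|=h$.
   Context: Nodes are the elements of $H$. Let $\ell$ be the maximum cardinality of a node of $H$. $T_H$ consists of the upper layer (nodes of $H$ of cardinality $\ell$) and the lower layer (nodes of $H$ of cardinality $\ell-1$), ordered by inclusion. For $y$ in the lower layer, $\mathsf{prec}(y)$ is the set of upper nodes containing $y$; for $x$ in the upper layer, $\mathsf{succ}(x)$ is the set of lower nodes contained in $x$. $T_H$ is closed under intersection if $|\mathsf{succ}(x)\cap\mathsf{succ}(x')|=1$ (i.e. $x\cap x'$ belongs to the lower layer) for every two distinct upper nodes $x,x'$. -}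

module Defs where

open import Data.Nat using (ℕ; _⊔_; _∸_; _≤_; _≥_)
open import Data.Nat.Properties using (_≟_)
open import Data.Fin.Subset using (Subset; _⊆_; ∣_∣)
open import Data.Fin.Subset.Properties using (_⊆?_)
open import Data.List using (List; filter; length; map; foldr)
open import Data.List.Membership.Propositional using (_∈_)
open import Data.Product using (_×_; ∃)
open import Relation.Binary.PropositionalEquality using (_≡_; _≢_)
open import Relation.Nullary using (¬_)
open import Relation.Nullary.Decidable using (_×-dec_)

-- A family H of subsets of N = Fin n, given as a (duplicate-free) list.
Family : ℕ → Set
Family n = List (Subset n)

module _ {n : ℕ} (H : Family n) where

  ℓ : ℕ
  ℓ = foldr _⊔_ 0 (map ∣_∣ H)

  upper : List (Subset n)
  upper = filter (λ x → ∣ x ∣ ≟ ℓ) H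

  lower : List (Subset n)
  lower = filter (λ y → ∣ y ∣ ≟ ℓ ∸ 1) H

  h : ℕ
  h = length upper

  prec : Subset n → List (Subset n)
  prec y = filter (λ x → y ⊆? x) upper

  succ : Subset n → List (Subset n)
  succ x = filter (λ y → y ⊆? x) lower

  succ∩ : Subset n → Subset n → List (Subset n)
  succ∩ x x' = filter (λ y → (y ⊆? x) ×-dec (y ⊆? x')) lower

  ClosedUnderIntersection : Set
  ClosedUnderIntersection =
    ∀ x x' → x ∈ upper → x' ∈ upper → x ≢ x' → length (succ∩ x x') ≡ 1

  Situation1 : Set
  Situation1 = ∀ y → y ∈ lower → length (prec y) ≤ 2

  Situation2 : Set
  Situation2 = (h ≥ 3) ×
    ∃ λ y → (y ∈ lower × length (prec y) ≡ h) ×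
            (∀ y' → y' ∈ lower → length (prec y') ≡ h → y' ≡ y)

{-# OPTIONS --safe #-}
module Submission where

-- Suppose a lower node y lies in three upper nodes a, b, c; these then pairwise meet exactly
-- in y. An upper node x not containing y would meet a, b, c in three lower nodes w₁, w₂, w₃.
-- As distinct facets of x, w₁ and w₂ already cover x, so w₃ ⊆ (a ∩ c) ∪ (b ∩ c) ⊆ y, and
-- w₃ ⊆ y ∩ x is too small. Hence y lies in every upper node, |prec y| = h ≥ 3, and y is the
-- only such lower node, since any other would lie in a ∩ c = y. If no lower node lies in
-- three upper nodes we are in Situation 1, and the two situations exclude each other.

open import Defs
open import Data.Nat using (ℕ; suc; _+_; _∸_; _≤_; _<_; s≤s; s≤s⁻¹; _≤?_)
open import Data.Nat.Properties
  using (<-irrefl; ≤-trans; ≤-reflexive; <-≤-trans; ≤-<-trans; +-suc; +-cancelʳ-≤; +-monoʳ-≤;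
         ≰⇒>; m≤n+m∸n; _≟_; module ≤-Reasoning)
open import Data.Fin.Subset using (Subset; ⊥; ⊤; inside; outside; _∩_; _∪_; ∣_∣; _⊆_)
open import Data.Fin.Subset.Properties
  using (p∩q⊆p; p∩q⊆q; x∈p∩q⁺; x∈p∪q⁻; p⊆q⇒∣p∣≤∣q∣; drop-∷-⊆; _⊆?_)
open import Data.Vec.Base using (_∷_; []; here)
open import Data.List using (List; _∷_; []; length)
open import Data.List.Relation.Unary.Any using (here; there; any?)
open import Data.List.Relation.Unary.All using (tabulate; _∷_)
open import Data.List.Relation.Unary.AllPairs using (_∷_)
open import Data.List.Relation.Unary.Unique.Propositional using (Unique)
import Data.List.Relation.Unary.Unique.Propositional.Properties as Unique
open import Data.List.Membership.Propositional using (_∈_; find; lose)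
open import Data.List.Membership.Propositional.Properties using (∈-filter⁻)
open import Data.List.Properties using (filter-all; filter-complete)
open import Data.Product using (_×_; _,_; proj₁; proj₂; ∃)
open import Data.Sum using (_⊎_; inj₁; inj₂)
open import Data.Empty using (⊥-elim) renaming (⊥ to False)
open import Relation.Binary.PropositionalEquality
  using (_≡_; _≢_; refl; sym; trans; cong; subst)
open import Relation.Nullary using (¬_; yes; no)
open import Relation.Nullary.Decidable using (_×-dec_)
open import Function using (_∘_; id)

private
  variable
    n : ℕ
    p q x y a b c w₁ w₂ w₃ : Subset n

p⊆q∧∣q∣≤∣p∣⇒p≡q : p ⊆ q → ∣ q ∣ ≤ ∣ p ∣ → p ≡ q
p⊆q∧∣q∣≤∣p∣⇒p≡q {p = []}          {[]}          _   _  = refl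
p⊆q∧∣q∣≤∣p∣⇒p≡q {p = outside ∷ p} {outside ∷ q} p⊆q le =
  cong (outside ∷_) (p⊆q∧∣q∣≤∣p∣⇒p≡q (drop-∷-⊆ p⊆q) le)
p⊆q∧∣q∣≤∣p∣⇒p≡q {p = outside ∷ p} {inside ∷ q}  p⊆q le =
  ⊥-elim (<-irrefl refl (≤-trans le (p⊆q⇒∣p∣≤∣q∣ (drop-∷-⊆ p⊆q))))
p⊆q∧∣q∣≤∣p∣⇒p≡q {p = inside ∷ p}  {outside ∷ q} p⊆q le with () ← p⊆q here
p⊆q∧∣q∣≤∣p∣⇒p≡q {p = inside ∷ p}  {inside ∷ q}  p⊆q (s≤s le) =
  cong (inside ∷_) (p⊆q∧∣q∣≤∣p∣⇒p≡q (drop-∷-⊆ p⊆q) le)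

p⊈q⇒∣p∩q∣<∣p∣ : ¬ p ⊆ q → ∣ p ∩ q ∣ < ∣ p ∣
p⊈q⇒∣p∩q∣<∣p∣ {p = p} {q} p⊈q with ∣ p ∣ ≤? ∣ p ∩ q ∣
... | no  ∣p∣≰∣p∩q∣ = ≰⇒> ∣p∣≰∣p∩q∣
... | yes ∣p∣≤∣p∩q∣ =
  ⊥-elim (p⊈q (subst (_⊆ q) (p⊆q∧∣q∣≤∣p∣⇒p≡q (p∩q⊆p p q) ∣p∣≤∣p∩q∣) (p∩q⊆q p q)))

∣p∪q∣+∣p∩q∣≡∣p∣+∣q∣ : (p q : Subset n) → ∣ p ∪ q ∣ + ∣ p ∩ q ∣ ≡ ∣ p ∣ + ∣ q ∣
∣p∪q∣+∣p∩q∣≡∣p∣+∣q∣ []            []            = refl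
∣p∪q∣+∣p∩q∣≡∣p∣+∣q∣ (outside ∷ p) (outside ∷ q) = ∣p∪q∣+∣p∩q∣≡∣p∣+∣q∣ p q
∣p∪q∣+∣p∩q∣≡∣p∣+∣q∣ (inside ∷ p)  (outside ∷ q) = cong suc (∣p∪q∣+∣p∩q∣≡∣p∣+∣q∣ p q)
∣p∪q∣+∣p∩q∣≡∣p∣+∣q∣ (outside ∷ p) (inside ∷ q)  =
  trans (cong suc (∣p∪q∣+∣p∩q∣≡∣p∣+∣q∣ p q)) (sym (+-suc (∣ p ∣) (∣ q ∣)))
∣p∪q∣+∣p∩q∣≡∣p∣+∣q∣ (inside ∷ p)  (inside ∷ q)  =
  cong suc (trans (+-suc (∣ p ∪ q ∣) (∣ p ∩ q ∣))
                  (trans (cong suc (∣p∪q∣+∣p∩q∣≡∣p∣+∣q∣ p q)) (sym (+-suc (∣ p ∣) (∣ q ∣)))))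

-- y is a facet of x. The bound is ≤ rather than ≡ so that layers of sizes ℓ ∸ 1 and ℓ fit
-- even when ℓ = 0.
_⋖_ : Subset n → Subset n → Set
y ⋖ x = y ⊆ x × ∣ x ∣ ≤ suc ∣ y ∣

common-facet⇒∩⊆ : a ≢ b → ∣ a ∣ ≡ ∣ b ∣ → y ⋖ a → y ⊆ b → a ∩ b ⊆ y
common-facet⇒∩⊆ {a = a} {b} {y} a≢b ∣a∣≡∣b∣ (y⊆a , ∣a∣≤1+∣y∣) y⊆b =
  subst (a ∩ b ⊆_) (sym y≡a∩b) id
  where
  a⊈b : ¬ a ⊆ b
  a⊈b a⊆b = a≢b (p⊆q∧∣q∣≤∣p∣⇒p≡q a⊆b (≤-reflexive (sym ∣a∣≡∣b∣)))
  y≡a∩b : y ≡ a ∩ b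
  y≡a∩b = p⊆q∧∣q∣≤∣p∣⇒p≡q (λ i → x∈p∩q⁺ (y⊆a i , y⊆b i))
            (s≤s⁻¹ (<-≤-trans (p⊈q⇒∣p∩q∣<∣p∣ a⊈b) ∣a∣≤1+∣y∣))

distinct-facets⇒⊆∪ : ∣ w₁ ∣ ≡ ∣ w₂ ∣ → w₁ ≢ w₂ → w₁ ⋖ x → w₂ ⊆ x → x ⊆ w₁ ∪ w₂
distinct-facets⇒⊆∪ {w₁ = w₁} {w₂} {x} ∣w₁∣≡∣w₂∣ w₁≢w₂ (w₁⊆x , ∣x∣≤1+∣w₁∣) w₂⊆x =
  subst (x ⊆_) (sym w₁∪w₂≡x) id
  where
  m = ∣ w₁ ∣
  ∣w₁∩w₂∣<m : ∣ w₁ ∩ w₂ ∣ < m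
  ∣w₁∩w₂∣<m = p⊈q⇒∣p∩q∣<∣p∣ (λ w₁⊆w₂ → w₁≢w₂ (p⊆q∧∣q∣≤∣p∣⇒p≡q w₁⊆w₂ (≤-reflexive (sym ∣w₁∣≡∣w₂∣))))
  m<∣w₁∪w₂∣ : suc m ≤ ∣ w₁ ∪ w₂ ∣
  m<∣w₁∪w₂∣ = +-cancelʳ-≤ (∣ w₁ ∩ w₂ ∣) (suc m) (∣ w₁ ∪ w₂ ∣) (begin
    suc m + ∣ w₁ ∩ w₂ ∣   ≡⟨ sym (+-suc m ∣ w₁ ∩ w₂ ∣) ⟩
    m + suc ∣ w₁ ∩ w₂ ∣   ≤⟨ +-monoʳ-≤ m ∣w₁∩w₂∣<m ⟩
    m + m                 ≡⟨ cong (m +_) ∣w₁∣≡∣w₂∣ ⟩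
    ∣ w₁ ∣ + ∣ w₂ ∣       ≡⟨ sym (∣p∪q∣+∣p∩q∣≡∣p∣+∣q∣ w₁ w₂) ⟩
    ∣ w₁ ∪ w₂ ∣ + ∣ w₁ ∩ w₂ ∣ ∎)
    where open ≤-Reasoning
  w₁∪w₂⊆x : w₁ ∪ w₂ ⊆ x
  w₁∪w₂⊆x i with x∈p∪q⁻ w₁ w₂ i
  ... | inj₁ i∈w₁ = w₁⊆x i∈w₁
  ... | inj₂ i∈w₂ = w₂⊆x i∈w₂
  w₁∪w₂≡x : w₁ ∪ w₂ ≡ x
  w₁∪w₂≡x = p⊆q∧∣q∣≤∣p∣⇒p≡q w₁∪w₂⊆x (≤-trans ∣x∣≤1+∣w₁∣ m<∣w₁∪w₂∣)

y⊈x⇒¬three-facets : ¬ y ⊆ x → ∣ w₁ ∣ ≡ ∣ y ∣ → ∣ w₂ ∣ ≡ ∣ y ∣ → ∣ w₃ ∣ ≡ ∣ y ∣ →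
  a ∩ b ⊆ y → a ∩ c ⊆ y → b ∩ c ⊆ y →
  w₁ ⋖ x → w₂ ⊆ x → w₃ ⊆ x → w₁ ⊆ a → w₂ ⊆ b → w₃ ⊆ c → False
y⊈x⇒¬three-facets {y = y} {x} {w₁} {w₂} {w₃} {a} {b} {c}
  y⊈x ∣w₁∣≡∣y∣ ∣w₂∣≡∣y∣ ∣w₃∣≡∣y∣ a∩b⊆y a∩c⊆y b∩c⊆y w₁⋖x w₂⊆x w₃⊆x w₁⊆a w₂⊆b w₃⊆c =
  too-big ∣w₃∣≡∣y∣ w₃⊆y∩x
  where
  too-big : ∀ {w} → ∣ w ∣ ≡ ∣ y ∣ → ¬ w ⊆ y ∩ x
  too-big ∣w∣≡∣y∣ w⊆y∩x =
    <-irrefl ∣w∣≡∣y∣ (≤-<-trans (p⊆q⇒∣p∣≤∣q∣ w⊆y∩x) (p⊈q⇒∣p∩q∣<∣p∣ y⊈x))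
  w₁≢w₂ : w₁ ≢ w₂
  w₁≢w₂ refl = too-big ∣w₁∣≡∣y∣ (λ i → x∈p∩q⁺ (a∩b⊆y (x∈p∩q⁺ (w₁⊆a i , w₂⊆b i)) , w₂⊆x i))
  x⊆w₁∪w₂ : x ⊆ w₁ ∪ w₂
  x⊆w₁∪w₂ = distinct-facets⇒⊆∪ (trans ∣w₁∣≡∣y∣ (sym ∣w₂∣≡∣y∣)) w₁≢w₂ w₁⋖x w₂⊆x
  w₃⊆y∩x : w₃ ⊆ y ∩ x
  w₃⊆y∩x i with x∈p∪q⁻ w₁ w₂ (x⊆w₁∪w₂ (w₃⊆x i))
  ... | inj₁ i∈w₁ = x∈p∩q⁺ (a∩c⊆y (x∈p∩q⁺ (w₁⊆a i∈w₁ , w₃⊆c i)) , w₃⊆x i)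
  ... | inj₂ i∈w₂ = x∈p∩q⁺ (b∩c⊆y (x∈p∩q⁺ (w₂⊆b i∈w₂ , w₃⊆c i)) , w₃⊆x i)

three-distinct : ∀ {A : Set} {zs : List A} → Unique zs → 3 ≤ length zs →
  ∃ λ a → ∃ λ b → ∃ λ c → (a ∈ zs × b ∈ zs × c ∈ zs) × (a ≢ b × a ≢ c × b ≢ c)
three-distinct {zs = _ ∷ []}     _ (s≤s ())
three-distinct {zs = _ ∷ _ ∷ []} _ (s≤s (s≤s ()))
three-distinct {zs = a ∷ b ∷ c ∷ _} ((a≢b ∷ a≢c ∷ _) ∷ (b≢c ∷ _) ∷ _) _ =
  a , b , c , (here refl , there (here refl) , there (there (here refl))) , (a≢b , a≢c , b≢c)

length≡1⇒∃∈ : ∀ {A : Set} {xs : List A} → length xs ≡ 1 → ∃ (_∈ xs)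
length≡1⇒∃∈ {xs = x ∷ _} _ = x , here refl

situation1⇒¬situation2 : (H : Family n) → Situation1 H → ¬ Situation2 H
situation1⇒¬situation2 H s1 (3≤h , y , (y∈lower , ∣prec∣≡h) , _) =
  <-irrefl refl (≤-trans 3≤h (subst (_≤ 2) ∣prec∣≡h (s1 y y∈lower)))

module Layers {n : ℕ} (H : Family n) (unique : Unique H) (closed : ClosedUnderIntersection H) where

  ∈upper⇒∣∣≡ℓ : x ∈ upper H → ∣ x ∣ ≡ ℓ H
  ∈upper⇒∣∣≡ℓ = proj₂ ∘ ∈-filter⁻ (λ x → ∣ x ∣ ≟ ℓ H) {xs = H}

  ∈lower⇒∣∣≡ℓ∸1 : y ∈ lower H → ∣ y ∣ ≡ ℓ H ∸ 1
  ∈lower⇒∣∣≡ℓ∸1 = proj₂ ∘ ∈-filter⁻ (λ y → ∣ y ∣ ≟ ℓ H ∸ 1) {xs = H}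

  ∈prec⁻ : x ∈ prec H y → x ∈ upper H × y ⊆ x
  ∈prec⁻ {y = y} = ∈-filter⁻ (y ⊆?_)

  lower⊆upper⇒⋖ : y ∈ lower H → x ∈ upper H → y ⊆ x → y ⋖ x
  lower⊆upper⇒⋖ {y = y} {x} y∈lower x∈upper y⊆x = y⊆x , (begin
    ∣ x ∣             ≡⟨ ∈upper⇒∣∣≡ℓ x∈upper ⟩
    ℓ H               ≤⟨ m≤n+m∸n (ℓ H) 1 ⟩
    suc (ℓ H ∸ 1)     ≡⟨ cong suc (sym (∈lower⇒∣∣≡ℓ∸1 y∈lower)) ⟩
    suc ∣ y ∣         ∎)
    where open ≤-Reasoning

  common-lower : x ∈ upper H → a ∈ upper H → x ≢ a → ∃ λ w → w ∈ lower H × w ⊆ x × w ⊆ a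
  common-lower {x = x} {a} x∈upper a∈upper x≢a
    with w , w∈succ∩ ← length≡1⇒∃∈ (closed x a x∈upper a∈upper x≢a)
    with w∈lower , w⊆x , w⊆a ← ∈-filter⁻ (λ w → (w ⊆? x) ×-dec (w ⊆? a)) w∈succ∩
    = w , w∈lower , w⊆x , w⊆a

  prec-∩⊆ : y ∈ lower H → a ∈ prec H y → b ∈ prec H y → a ≢ b → a ∩ b ⊆ y
  prec-∩⊆ y∈lower a∈prec b∈prec a≢b =
    common-facet⇒∩⊆ a≢b (trans (∈upper⇒∣∣≡ℓ a∈upper) (sym (∈upper⇒∣∣≡ℓ b∈upper)))
      (lower⊆upper⇒⋖ y∈lower a∈upper y⊆a) y⊆b
    where
    a∈upper = proj₁ (∈prec⁻ a∈prec)
    y⊆a = proj₂ (∈prec⁻ a∈prec)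
    b∈upper = proj₁ (∈prec⁻ b∈prec)
    y⊆b = proj₂ (∈prec⁻ b∈prec)

  common-lower-with-prec : x ∈ upper H → ¬ y ⊆ x → a ∈ prec H y →
    ∃ λ w → w ∈ lower H × w ⊆ x × w ⊆ a
  common-lower-with-prec x∈upper y⊈x a∈prec with a∈upper , y⊆a ← ∈prec⁻ a∈prec =
    common-lower x∈upper a∈upper (λ { refl → y⊈x y⊆a })

  three-prec⇒⊆upper : y ∈ lower H → a ∈ prec H y → b ∈ prec H y → c ∈ prec H y →
    a ≢ b → a ≢ c → b ≢ c → x ∈ upper H → y ⊆ x
  three-prec⇒⊆upper {y = y} {a} {b} {c} {x} y∈lower a∈prec b∈prec c∈prec a≢b a≢c b≢c x∈upper
    with y ⊆? x
  ... | yes y⊆x = y⊆x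
  ... | no  y⊈x
    with w₁ , w₁∈lower , w₁⊆x , w₁⊆a ← common-lower-with-prec x∈upper y⊈x a∈prec
       | w₂ , w₂∈lower , w₂⊆x , w₂⊆b ← common-lower-with-prec x∈upper y⊈x b∈prec
       | w₃ , w₃∈lower , w₃⊆x , w₃⊆c ← common-lower-with-prec x∈upper y⊈x c∈prec
    = ⊥-elim (y⊈x⇒¬three-facets y⊈x (same-size w₁∈lower) (same-size w₂∈lower) (same-size w₃∈lower)
        (prec-∩⊆ y∈lower a∈prec b∈prec a≢b) (prec-∩⊆ y∈lower a∈prec c∈prec a≢c)
        (prec-∩⊆ y∈lower b∈prec c∈prec b≢c)
        (lower⊆upper⇒⋖ w₁∈lower x∈upper w₁⊆x) w₂⊆x w₃⊆x w₁⊆a w₂⊆b w₃⊆c)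
    where
    same-size : ∀ {w} → w ∈ lower H → ∣ w ∣ ≡ ∣ y ∣
    same-size w∈lower = trans (∈lower⇒∣∣≡ℓ∸1 w∈lower) (sym (∈lower⇒∣∣≡ℓ∸1 y∈lower))

  ⊆upper⇒∣prec∣≡h : (∀ {x} → x ∈ upper H → y ⊆ x) → length (prec H y) ≡ h H
  ⊆upper⇒∣prec∣≡h {y = y} ⊆upper = cong length (filter-all (y ⊆?_) (tabulate ⊆upper))

  ∣prec∣≡h⇒⊆upper : length (prec H y) ≡ h H → x ∈ upper H → y ⊆ x
  ∣prec∣≡h⇒⊆upper {y = y} ∣prec∣≡h x∈upper =
    proj₂ (∈prec⁻ (subst (_ ∈_) (sym (filter-complete (y ⊆?_) ∣prec∣≡h)) x∈upper))

  three-prec⇒situation2 : y ∈ lower H → 3 ≤ length (prec H y) → Situation2 H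
  three-prec⇒situation2 {y = y} y∈lower 3≤∣prec∣
    with a , b , c , (a∈prec , b∈prec , c∈prec) , (a≢b , a≢c , b≢c)
           ← three-distinct (Unique.filter⁺ (y ⊆?_) (Unique.filter⁺ (λ x → ∣ x ∣ ≟ ℓ H) unique)) 3≤∣prec∣
    = subst (3 ≤_) ∣prec∣≡h 3≤∣prec∣ , y , (y∈lower , ∣prec∣≡h) , unique-full
    where
    ∣prec∣≡h : length (prec H y) ≡ h H
    ∣prec∣≡h = ⊆upper⇒∣prec∣≡h
      (three-prec⇒⊆upper y∈lower a∈prec b∈prec c∈prec a≢b a≢c b≢c)
    unique-full : ∀ y' → y' ∈ lower H → length (prec H y') ≡ h H → y' ≡ y
    unique-full y' y'∈lower ∣prec'∣≡h =
      p⊆q∧∣q∣≤∣p∣⇒p≡q (λ i → prec-∩⊆ y∈lower a∈prec c∈prec a≢c (x∈p∩q⁺ (⊆a i , ⊆c i)))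
        (≤-reflexive (trans (∈lower⇒∣∣≡ℓ∸1 y∈lower) (sym (∈lower⇒∣∣≡ℓ∸1 y'∈lower))))
      where
      ⊆a = ∣prec∣≡h⇒⊆upper ∣prec'∣≡h (proj₁ (∈prec⁻ a∈prec))
      ⊆c = ∣prec∣≡h⇒⊆upper ∣prec'∣≡h (proj₁ (∈prec⁻ c∈prec))

lemma3 : (n : ℕ) (H : Family n) → Unique H →
    (∀ x → x ∈ H → x ≢ ⊥ × x ≢ ⊤) →
    ClosedUnderIntersection H →
    (Situation1 H × ¬ Situation2 H) ⊎ (¬ Situation1 H × Situation2 H)
lemma3 _ H unique _ closed with any? (λ y → 3 ≤? length (prec H y)) (lower H)
... | yes some with y , y∈lower , 3≤∣prec∣ ← find some =
  inj₂ ( (λ s1 → <-irrefl refl (≤-trans 3≤∣prec∣ (s1 y y∈lower)))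
       , Layers.three-prec⇒situation2 H unique closed y∈lower 3≤∣prec∣)
... | no none = inj₁ (s1 , situation1⇒¬situation2 H s1)
  where
  s1 : Situation1 H
  s1 y y∈lower with 3 ≤? length (prec H y)
  ... | yes 3≤∣prec∣ = ⊥-elim (none (lose y∈lower 3≤∣prec∣))
  ... | no  3≰∣prec∣ = s≤s⁻¹ (≰⇒> 3≰∣prec∣)
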